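{- Let $T$ be a finite tree. Then \[\mathcal{N}(T)=\bigoplus_{S\in\mathcal{F}_{S}(T)} \uparrow_{S}^{T}\mathcal{N}(S),\] where $\uparrow_S^T\mathcal{N}(S)=\{\uparrow_S^T x : x\in\mathcal{N}(S)\}$. Consequently $\eta(T)=\sum_{S\in\mathcal{F}_{S}(T)}\eta(S)$.
   Context: For a graph $G$, $\mathcal{N}(G)\subseteq\mathbb{R}^{V(G)}$ is the null space of the adjacency matrix $A(G)$ and $\eta(G)=\dim\mathcal{N}(G)$ is its nullity. $\operatorname{Supp}(T)=\{v\in V(T): x_v\neq0\text{ for some }x\in\mathcal{N}(T)\}$. $\mathcal{F}_{S}(T)$ is the set of connected components of the induced subgraph $T\langle N[\operatorname{Supp}(T)]\rangle$, where $N[X]=\bigcup_{u\in X}(N(u)\cup\{u\})$. For an induced subgraph $H$ of $T$ and $x\in\mathbb{R}^{V(H)}$, the lift $\uparrow_H^T x\in\mathbb{R}^{V(T)}$ agrees with $x$ on $V(H)$ and is $0$ on $V(T)\setminus V(H)$.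
   Formalization: The null spaces $\mathcal{N}(T)$ and $\mathcal{N}(S)$ are taken over ℚ rather than ℝ, so Supp(T), $\mathcal{F}_{S}(T)$ and the nullities are defined through rational null vectors. -}

module Defs where

open import Data.Bool using (Bool; true; false)
open import Data.Nat as ℕ using (ℕ; zero; suc; _≤_)
open import Data.Fin using (Fin; zero; suc)
open import Data.Fin.Subset using (Subset; _∈_)
open import Data.Fin.Subset.Properties using (_∈?_)
open import Data.Rational using (ℚ; 0ℚ; 1ℚ; _+_; _*_)
open import Data.List using (List; []; _∷_; length)
open import Data.List.Relation.Unary.Unique.Propositional using (Unique)
open import Data.Product using (Σ; ∃; _×_; _,_; proj₁)
open import Data.Sum using (_⊎_)
open import Data.Unit using (⊤)
open import Data.Empty using (⊥)
open import Relation.Nullary using (¬_; yes; no)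
open import Relation.Binary.PropositionalEquality using (_≡_; _≢_)

∑ : ∀ {k} → (Fin k → ℚ) → ℚ
∑ {zero}  f = 0ℚ
∑ {suc k} f = f zero + ∑ (λ i → f (suc i))

∑ℕ : ∀ {k} → (Fin k → ℕ) → ℕ
∑ℕ {zero}  f = 0
∑ℕ {suc k} f = f zero ℕ.+ ∑ℕ (λ i → f (suc i))

record Graph (n : ℕ) : Set where
  field
    adj    : Fin n → Fin n → Bool
    sym    : ∀ u v → adj u v ≡ adj v u
    irrefl : ∀ v → adj v v ≡ false
open Graph public

module _ {n : ℕ} (G : Graph n) where

  A : Fin n → Fin n → ℚ
  A i j with adj G i j
  ... | true  = 1ℚ
  ... | false = 0ℚ

  Adj : Fin n → Fin n → Set
  Adj u v = adj G u v ≡ true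

  data ReachIn (P : Fin n → Set) : Fin n → Fin n → Set where
    here : ∀ {u} → P u → ReachIn P u u
    step : ∀ {u v w} → P u → Adj u v → ReachIn P v w → ReachIn P u w

  Connected : Set
  Connected = ∀ u v → ReachIn (λ _ → ⊤) u v

  AdjChain : List (Fin n) → Set
  AdjChain []            = ⊤
  AdjChain (x ∷ [])      = ⊤
  AdjChain (x ∷ y ∷ r)   = Adj x y × AdjChain (y ∷ r)

  lastOr : Fin n → List (Fin n) → Fin n
  lastOr d []      = d
  lastOr d (x ∷ r) = lastOr x r

  IsCycle : List (Fin n) → Set
  IsCycle []       = ⊥
  IsCycle (v ∷ vs) = (3 ≤ length (v ∷ vs)) × Unique (v ∷ vs) × AdjChain (v ∷ vs)
                     × Adj (lastOr v vs) v

  Acyclic : Set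
  Acyclic = ∀ vs → ¬ IsCycle vs

  IsTree : Set
  IsTree = (1 ≤ n) × Connected × Acyclic

  IsNull : (Fin n → ℚ) → Set
  IsNull x = ∀ i → ∑ (λ j → A i j * x j) ≡ 0ℚ

  Supp : Fin n → Set
  Supp v = Σ (Fin n → ℚ) (λ x → IsNull x × x v ≢ 0ℚ)

  NSupp : Fin n → Set
  NSupp w = ∃ λ u → Supp u × (u ≡ w ⊎ Adj u w)

  -- C is (the vertex set of) a connected component of G⟨N[Supp(G)]⟩
  IsSuppComponent : Subset n → Set
  IsSuppComponent C =
      (∃ λ v → v ∈ C)
    × (∀ v → v ∈ C → NSupp v)
    × (∀ u v → u ∈ C → v ∈ C → ReachIn NSupp u v)
    × (∀ u v → u ∈ C → NSupp v → Adj u v → v ∈ C)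

  EnumeratesFS : ∀ {m} → (Fin m → Subset n) → Set
  EnumeratesFS Cs =
      (∀ k → IsSuppComponent (Cs k))
    × (∀ k l → Cs k ≡ Cs l → k ≡ l)
    × (∀ C → IsSuppComponent C → ∃ λ k → Cs k ≡ C)

  Elem : Subset n → Set
  Elem S = Σ (Fin n) (λ v → v ∈ S)

  -- entry (A(G⟨S⟩) y)_i  =  Σ_{j ∈ S} A i j * y j
  rowIn : (S : Subset n) → (Elem S → ℚ) → Fin n → Fin n → ℚ
  rowIn S y i j with j ∈? S
  ... | yes p = A i j * y (j , p)
  ... | no _  = 0ℚ

  IsNullIn : (S : Subset n) → (Elem S → ℚ) → Set
  IsNullIn S y = ∀ (i : Elem S) → ∑ (λ j → rowIn S y (proj₁ i) j) ≡ 0ℚ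

  lift : (S : Subset n) → (Elem S → ℚ) → Fin n → ℚ
  lift S y v with v ∈? S
  ... | yes p = y (v , p)
  ... | no _  = 0ℚ

  -- N(G) = ⊕_k ↑ N(G⟨Cs k⟩)  (internal direct sum inside ℚ^{V(G)})
  DirectSumDecomp : ∀ {m} → (Fin m → Subset n) → Set
  DirectSumDecomp {m} Cs =
      (∀ k (y : Elem (Cs k) → ℚ) → IsNullIn (Cs k) y → IsNull (lift (Cs k) y))
    × (∀ x → IsNull x →
         Σ ((k : Fin m) → Elem (Cs k) → ℚ) λ ys →
           (∀ k → IsNullIn (Cs k) (ys k))
         × (∀ v → x v ≡ ∑ (λ k → lift (Cs k) (ys k) v)))
    × (∀ (ys : (k : Fin m) → Elem (Cs k) → ℚ) →
         (∀ k → IsNullIn (Cs k) (ys k)) →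
         (∀ v → ∑ (λ k → lift (Cs k) (ys k) v) ≡ 0ℚ) →
         ∀ k e → ys k e ≡ 0ℚ)

HasDim : {X : Set} → ((X → ℚ) → Set) → ℕ → Set
HasDim {X} P d =
  Σ (Fin d → X → ℚ) λ b →
      (∀ k → P (b k))
    × (∀ (c : Fin d → ℚ) → (∀ x → ∑ (λ k → c k * b k x) ≡ 0ℚ) → ∀ k → c k ≡ 0ℚ)
    × (∀ v → P v → Σ (Fin d → ℚ) λ c → ∀ x → v x ≡ ∑ (λ k → c k * b k x))

{-# OPTIONS --safe #-}
-- In a forest, a null vector x and a null vector y of the adjacency matrix restricted to a
-- vertex set R (both vanishing next to R) satisfy x u * y v = 0 on every edge uv of R: the
-- row of a leaf ℓ forces both to vanish at its neighbour p, and deleting p preserves all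
-- hypotheses.  For a component C of T⟨N[Supp T]⟩ this makes a null vector of C vanish at
-- every vertex of C with a neighbour outside C, so its lift is a null vector of T.
-- Conversely a null vector of T vanishes off Supp T, in particular next to every component,
-- so it restricts to null vectors of the components; these are disjoint and cover Supp T,
-- so the lifts of the restrictions add up to it.  Summing dimensions amounts to
-- concatenating bases, together with the uniqueness of dimension (Steinitz exchange, from a
-- nontrivial solution of an underdetermined homogeneous system).

module Submission where

open import Defs renaming (sym to adj-sym)
open import Data.Nat using (ℕ)
open import Data.Fin using (Fin)
open import Data.Fin.Subset using (Subset)
open import Data.Product using (_×_)
open import Relation.Binary.PropositionalEquality using (_≡_)

open import Algebra.Bundles using (CommutativeRing)
import Algebra.Properties.Semiring.Sum as SemiringSum
open import Data.Bool using (true; false) renaming (_≟_ to _≟ᵇ_)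
open import Data.Empty using (⊥-elim)
open import Data.Fin using (zero; suc; punchIn; punchOut; splitAt; _↑ˡ_; _↑ʳ_) renaming (_≟_ to _≟ᶠ_)
open import Data.Fin.Properties
  using (any?; punchInᵢ≢i; punchIn-punchOut; splitAt-↑ˡ; splitAt-↑ʳ; splitAt⁻¹-↑ˡ; splitAt⁻¹-↑ʳ)
open import Data.Fin.Subset using (_∈_; _∉_; _─_; ⊤; ∣_∣; ⁅_⁆)
open import Data.Fin.Subset.Properties
  using (_∈?_; ∈⊤; ⊆-antisym; p─q⊆p; x∈p∧x≢y⇒x∈p-y; x∈p⇒∣p-x∣<∣p∣)
open import Data.List using (List; []; _∷_; length)
open import Data.List.Membership.Propositional using () renaming (_∈_ to _∈ₗ_; _∉_ to _∉ₗ_)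
import Data.List.Membership.DecPropositional as DecMembership
open import Data.List.Relation.Unary.All using (All; []; _∷_)
open import Data.List.Relation.Unary.All.Properties using (¬Any⇒All¬)
open import Data.List.Relation.Unary.AllPairs using ([]; _∷_)
open import Data.List.Relation.Unary.Any using (here; there)
open import Data.List.Relation.Unary.Unique.Propositional using (Unique)
open import Data.Nat as ℕ using (zero; suc; _<_; _≤_; z≤n; s≤s)
open import Data.Nat.Induction using (<-wellFounded)
open import Data.Nat.Properties using (≤-antisym; ≰⇒>)
open import Data.Product using (Σ; ∃; ∃₂; _,_; proj₁; proj₂; uncurry)
open import Data.Rational using (ℚ; 0ℚ; 1ℚ; _+_; _*_; -_; _-_; 1/_; NonZero; ≢-nonZero)
  renaming (_≟_ to _≟ℚ_)
open import Data.Rational.Properties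
  using (+-*-commutativeRing; +-identityˡ; +-identityʳ; +-assoc; +-inverseʳ;
         *-identityˡ; *-identityʳ; *-zeroˡ; *-zeroʳ; *-assoc; *-inverseˡ)
open import Data.Rational.Solver using (module +-*-Solver)
open import Data.Sum using (_⊎_; inj₁; inj₂; fromInj₂)
open import Data.Unit using (tt)
open import Data.Vec using (tabulate)
open import Data.Vec.Properties using (lookup∘tabulate; []=⇒lookup; lookup⇒[]=)
open import Data.Vec.Properties.WithK using ([]=-irrelevant)
open import Function using (_∘_)
open import Induction.WellFounded using (Acc; acc)
open import Relation.Nullary using (¬_; Dec; yes; no; does; ¬?)
open import Relation.Nullary.Decidable using (decidable-stable; _×-dec_; dec-true)
open import Relation.Nullary.Decidable.Core using (¬¬-excluded-middle)
open import Relation.Nullary.Negation using (¬¬-map; contradiction)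
open import Relation.Binary.PropositionalEquality
  using (_≢_; refl; sym; trans; cong; cong₂; subst; module ≡-Reasoning)

module Sum = SemiringSum (CommutativeRing.semiring +-*-commutativeRing)

open +-*-Solver

∑≡sum : ∀ {k} (f : Fin k → ℚ) → ∑ f ≡ Sum.sum f
∑≡sum {zero}  f = refl
∑≡sum {suc k} f = cong (f zero +_) (∑≡sum (f ∘ suc))

∑-cong : ∀ {k} {f g : Fin k → ℚ} → (∀ i → f i ≡ g i) → ∑ f ≡ ∑ g
∑-cong {f = f} {g} f≗g = trans (∑≡sum f) (trans (Sum.sum-cong-≗ f≗g) (sym (∑≡sum g)))

∑-zero : ∀ {k} {f : Fin k → ℚ} → (∀ i → f i ≡ 0ℚ) → ∑ f ≡ 0ℚ
∑-zero {k} {f} f≗0 = trans (∑≡sum f) (trans (Sum.sum-cong-≗ f≗0) (Sum.sum-replicate-zero k))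

∑-single : ∀ {k} {f : Fin k → ℚ} (p : Fin k) → (∀ j → j ≢ p → f j ≡ 0ℚ) → ∑ f ≡ f p
∑-single {suc k} {f} p others = begin
  ∑ f                             ≡⟨ ∑≡sum f ⟩
  Sum.sum f                       ≡⟨ Sum.sum-remove {i = p} f ⟩
  f p + Sum.sum (f ∘ punchIn p)   ≡⟨ cong (f p +_) (∑≡sum (f ∘ punchIn p)) ⟨
  f p + ∑ (f ∘ punchIn p)         ≡⟨ cong (f p +_) (∑-zero (λ j → others _ (punchInᵢ≢i p j))) ⟩
  f p + 0ℚ                        ≡⟨ +-identityʳ (f p) ⟩
  f p                             ∎
  where open ≡-Reasoning

∑-distrib-+ : ∀ {k} (f g : Fin k → ℚ) → ∑ (λ i → f i + g i) ≡ ∑ f + ∑ g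
∑-distrib-+ f g = begin
  ∑ (λ i → f i + g i)         ≡⟨ ∑≡sum (λ i → f i + g i) ⟩
  Sum.sum (λ i → f i + g i)   ≡⟨ Sum.∑-distrib-+ f g ⟩
  Sum.sum f + Sum.sum g       ≡⟨ cong₂ _+_ (∑≡sum f) (∑≡sum g) ⟨
  ∑ f + ∑ g                   ∎
  where open ≡-Reasoning

*-distribˡ-∑ : ∀ {k} (c : ℚ) (f : Fin k → ℚ) → c * ∑ f ≡ ∑ (λ i → c * f i)
*-distribˡ-∑ c f = begin
  c * ∑ f                     ≡⟨ cong (c *_) (∑≡sum f) ⟩
  c * Sum.sum f               ≡⟨ Sum.*-distribˡ-sum c f ⟩
  Sum.sum (λ i → c * f i)     ≡⟨ ∑≡sum (λ i → c * f i) ⟨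
  ∑ (λ i → c * f i)           ∎
  where open ≡-Reasoning

*-distribʳ-∑ : ∀ {k} (c : ℚ) (f : Fin k → ℚ) → ∑ f * c ≡ ∑ (λ i → f i * c)
*-distribʳ-∑ c f = begin
  ∑ f * c                     ≡⟨ cong (_* c) (∑≡sum f) ⟩
  Sum.sum f * c               ≡⟨ Sum.*-distribʳ-sum c f ⟩
  Sum.sum (λ i → f i * c)     ≡⟨ ∑≡sum (λ i → f i * c) ⟨
  ∑ (λ i → f i * c)           ∎
  where open ≡-Reasoning

∑-comm : ∀ {a b} (f : Fin a → Fin b → ℚ) → ∑ (λ i → ∑ (f i)) ≡ ∑ (λ j → ∑ (λ i → f i j))
∑-comm f = begin
  ∑ (λ i → ∑ (f i))                       ≡⟨ ∑∑≡sum-sum f ⟩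
  Sum.sum (λ i → Sum.sum (f i))           ≡⟨ Sum.∑-comm f ⟩
  Sum.sum (λ j → Sum.sum (λ i → f i j))   ≡⟨ ∑∑≡sum-sum (λ j i → f i j) ⟨
  ∑ (λ j → ∑ (λ i → f i j))               ∎
  where
  open ≡-Reasoning
  ∑∑≡sum-sum : ∀ {a b} (g : Fin a → Fin b → ℚ) → ∑ (λ i → ∑ (g i)) ≡ Sum.sum (λ i → Sum.sum (g i))
  ∑∑≡sum-sum g = trans (∑≡sum (λ i → ∑ (g i))) (Sum.sum-cong-≗ (∑≡sum ∘ g))

∑-splitAt : ∀ a b (f : Fin (a ℕ.+ b) → ℚ) → ∑ f ≡ ∑ (λ i → f (i ↑ˡ b)) + ∑ (λ j → f (a ↑ʳ j))
∑-splitAt zero    b f = sym (+-identityˡ _)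
∑-splitAt (suc a) b f = trans (cong (f zero +_) (∑-splitAt a b (f ∘ suc))) (sym (+-assoc (f zero) _ _))

∑-combination-linear : ∀ {k} (c f g : Fin k → ℚ) (β : ℚ) →
  ∑ (λ i → c i * (f i - β * g i)) ≡ ∑ (λ i → c i * f i) - β * ∑ (λ i → c i * g i)
∑-combination-linear c f g β = begin
  ∑ (λ i → c i * (f i - β * g i))
    ≡⟨ ∑-cong (λ i → solve 4 (λ c f g β → c :* (f :- β :* g) := c :* f :+ (:- β) :* (c :* g))
                              refl (c i) (f i) (g i) β) ⟩
  ∑ (λ i → c i * f i + (- β) * (c i * g i))
    ≡⟨ ∑-distrib-+ (λ i → c i * f i) (λ i → (- β) * (c i * g i)) ⟩
  ∑ (λ i → c i * f i) + ∑ (λ i → (- β) * (c i * g i))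
    ≡⟨ cong (∑ (λ i → c i * f i) +_) (*-distribˡ-∑ (- β) (λ i → c i * g i)) ⟨
  ∑ (λ i → c i * f i) + (- β) * ∑ (λ i → c i * g i)
    ≡⟨ solve 3 (λ x β y → x :+ (:- β) :* y := x :- β :* y) refl (∑ (λ i → c i * f i)) β _ ⟩
  ∑ (λ i → c i * f i) - β * ∑ (λ i → c i * g i)
    ∎
  where open ≡-Reasoning

∑-combination-of-combinations : ∀ {a b} (c : Fin a → ℚ) (d : Fin a → Fin b → ℚ) (w : Fin b → ℚ) →
  ∑ (λ k → c k * ∑ (λ l → d k l * w l)) ≡ ∑ (λ l → ∑ (λ k → c k * d k l) * w l)
∑-combination-of-combinations c d w = begin
  ∑ (λ k → c k * ∑ (λ l → d k l * w l))
    ≡⟨ ∑-cong (λ k → *-distribˡ-∑ (c k) (λ l → d k l * w l)) ⟩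
  ∑ (λ k → ∑ (λ l → c k * (d k l * w l)))
    ≡⟨ ∑-cong (λ k → ∑-cong (λ l → *-assoc (c k) (d k l) (w l))) ⟨
  ∑ (λ k → ∑ (λ l → c k * d k l * w l))
    ≡⟨ ∑-comm (λ k l → c k * d k l * w l) ⟩
  ∑ (λ l → ∑ (λ k → c k * d k l * w l))
    ≡⟨ ∑-cong (λ l → *-distribʳ-∑ (w l) (λ k → c k * d k l)) ⟨
  ∑ (λ l → ∑ (λ k → c k * d k l) * w l)
    ∎
  where open ≡-Reasoning

Solves : ∀ {m a} → (Fin m → Fin a → ℚ) → (Fin a → ℚ) → Set
Solves E c = ∀ r → ∑ (λ k → c k * E r k) ≡ 0ℚ

module GaussStep {m a} (E : Fin (suc m) → Fin (suc a) → ℚ) (r₀ : Fin (suc m)) (α≢0 : E r₀ zero ≢ 0ℚ)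
  where

  α : ℚ
  α = E r₀ zero

  instance
    α-nonZero : NonZero α
    α-nonZero = ≢-nonZero α≢0

  eliminate : Fin m → Fin a → ℚ
  eliminate r k = E (punchIn r₀ r) (suc k) - (E (punchIn r₀ r) zero * 1/ α) * E r₀ (suc k)

  backSubstitute : (Fin a → ℚ) → Fin (suc a) → ℚ
  backSubstitute c zero    = - (1/ α * ∑ (λ k → c k * E r₀ (suc k)))
  backSubstitute c (suc k) = c k

  backSubstitute-solves : ∀ c → Solves eliminate c → Solves E (backSubstitute c)
  backSubstitute-solves c sol r with r₀ ≟ᶠ r
  ... | yes refl = begin
    - (1/ α * S) * α + S    ≡⟨ solve 3 (λ ι s a → (:- (ι :* s)) :* a :+ s := s :- s :* (ι :* a))
                                       refl (1/ α) S α ⟩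
    S - S * (1/ α * α)      ≡⟨ cong (λ z → S - S * z) (*-inverseˡ α) ⟩
    S - S * 1ℚ              ≡⟨ cong (λ z → S - z) (*-identityʳ S) ⟩
    S - S                   ≡⟨ +-inverseʳ S ⟩
    0ℚ                      ∎
    where
    open ≡-Reasoning
    S = ∑ (λ k → c k * E r₀ (suc k))
  ... | no r₀≢r = subst (λ r → ∑ (λ k → backSubstitute c k * E r k) ≡ 0ℚ) (punchIn-punchOut r₀≢r)
                        (other-row (punchOut r₀≢r))
    where
    other-row : ∀ r′ → ∑ (λ k → backSubstitute c k * E (punchIn r₀ r′) k) ≡ 0ℚ
    other-row r′ = begin
      - (1/ α * S) * β + X             ≡⟨ solve 4 (λ ι s b x → (:- (ι :* s)) :* b :+ x := x :- (b :* ι) :* s)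
                                                  refl (1/ α) S β X ⟩
      X - (β * 1/ α) * S               ≡⟨ ∑-combination-linear c (λ k → E (punchIn r₀ r′) (suc k))
                                                               (λ k → E r₀ (suc k)) (β * 1/ α) ⟨
      ∑ (λ k → c k * eliminate r′ k)   ≡⟨ sol r′ ⟩
      0ℚ                               ∎
      where
      open ≡-Reasoning
      S = ∑ (λ k → c k * E r₀ (suc k))
      β = E (punchIn r₀ r′) zero
      X = ∑ (λ k → c k * E (punchIn r₀ r′) (suc k))

homogeneous-nontrivial-solution : ∀ m {a} → m < a → (E : Fin m → Fin a → ℚ) →
  ∃ λ c → (∃ λ k → c k ≢ 0ℚ) × Solves E c
homogeneous-nontrivial-solution zero    {suc a} _ E = (λ _ → 1ℚ) , (zero , λ ()) , λ ()
homogeneous-nontrivial-solution (suc m) {suc a} (s≤s m<a) E with any? (λ r → ¬? (E r zero ≟ℚ 0ℚ))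
... | no column₀-zero = e₀ , (zero , λ ()) , e₀-solves
  where
  e₀ : Fin (suc a) → ℚ
  e₀ zero    = 1ℚ
  e₀ (suc _) = 0ℚ
  e₀-solves : Solves E e₀
  e₀-solves r = begin
    ∑ (λ k → e₀ k * E r k)   ≡⟨ ∑-single zero others ⟩
    1ℚ * E r zero             ≡⟨ *-identityˡ (E r zero) ⟩
    E r zero                  ≡⟨ decidable-stable (E r zero ≟ℚ 0ℚ) (λ α≢0 → column₀-zero (r , α≢0)) ⟩
    0ℚ                        ∎
    where
    open ≡-Reasoning
    others : ∀ k → k ≢ zero → e₀ k * E r k ≡ 0ℚ
    others zero    0≢0 = ⊥-elim (0≢0 refl)
    others (suc k) _   = *-zeroˡ (E r (suc k))
... | yes (r₀ , α≢0) with homogeneous-nontrivial-solution m m<a (GaussStep.eliminate E r₀ α≢0)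
...   | c , (k , cₖ≢0) , sol = backSubstitute c , (suc k , cₖ≢0) , backSubstitute-solves c sol
  where open GaussStep E r₀ α≢0

LinearlyIndependent : {X : Set} {d : ℕ} → (Fin d → X → ℚ) → Set
LinearlyIndependent {X} {d} b =
  ∀ (c : Fin d → ℚ) → (∀ x → ∑ (λ k → c k * b k x) ≡ 0ℚ) → ∀ k → c k ≡ 0ℚ

InSpan : {X : Set} {d : ℕ} → (Fin d → X → ℚ) → (X → ℚ) → Set
InSpan {X} {d} b v = Σ (Fin d → ℚ) λ c → ∀ x → v x ≡ ∑ (λ k → c k * b k x)

independent-≤-spanning : ∀ {X : Set} {a b} {u : Fin a → X → ℚ} (w : Fin b → X → ℚ) →
  LinearlyIndependent u → (∀ k → InSpan w (u k)) → a ≤ b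
independent-≤-spanning {a = a} {b} {u} w u-independent u∈span with a ℕ.≤? b
... | yes a≤b = a≤b
... | no a≰b with homogeneous-nontrivial-solution b (≰⇒> a≰b) (λ l k → proj₁ (u∈span k) l)
...   | c , (k , cₖ≢0) , sol = ⊥-elim (cₖ≢0 (u-independent c combination-vanishes k))
  where
  d : ∀ k l → ℚ
  d k = proj₁ (u∈span k)
  combination-vanishes : ∀ x → ∑ (λ k → c k * u k x) ≡ 0ℚ
  combination-vanishes x = begin
    ∑ (λ k → c k * u k x)
      ≡⟨ ∑-cong (λ k → cong (c k *_) (proj₂ (u∈span k) x)) ⟩
    ∑ (λ k → c k * ∑ (λ l → d k l * w l x))
      ≡⟨ ∑-combination-of-combinations c d (λ l → w l x) ⟩
    ∑ (λ l → ∑ (λ k → c k * d k l) * w l x)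
      ≡⟨ ∑-zero (λ l → trans (cong (_* w l x) (sol l)) (*-zeroˡ (w l x))) ⟩
    0ℚ
      ∎
    where open ≡-Reasoning

HasDim-unique : ∀ {X : Set} {P : (X → ℚ) → Set} {a b} → HasDim P a → HasDim P b → a ≡ b
HasDim-unique (u , u∈P , u-independent , P⊆span-u) (w , w∈P , w-independent , P⊆span-w) =
  ≤-antisym (independent-≤-spanning w u-independent (λ k → P⊆span-w (u k) (u∈P k)))
            (independent-≤-spanning u w-independent (λ l → P⊆span-u (w l) (w∈P l)))

splitΣ : ∀ {m} (ηs : Fin m → ℕ) → Fin (∑ℕ ηs) → Σ (Fin m) (Fin ∘ ηs)
splitΣ {suc m} ηs i with splitAt (ηs zero) i
... | inj₁ t = zero , t
... | inj₂ j = suc (proj₁ (splitΣ (ηs ∘ suc) j)) , proj₂ (splitΣ (ηs ∘ suc) j)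

joinΣ : ∀ {m} (ηs : Fin m → ℕ) → Σ (Fin m) (Fin ∘ ηs) → Fin (∑ℕ ηs)
joinΣ {suc m} ηs (zero  , t) = t ↑ˡ ∑ℕ (ηs ∘ suc)
joinΣ {suc m} ηs (suc k , t) = ηs zero ↑ʳ joinΣ (ηs ∘ suc) (k , t)

joinΣ-splitΣ : ∀ {m} (ηs : Fin m → ℕ) i → joinΣ ηs (splitΣ ηs i) ≡ i
joinΣ-splitΣ {suc m} ηs i with splitAt (ηs zero) i in eq
... | inj₁ t = splitAt⁻¹-↑ˡ eq
... | inj₂ j = trans (cong (ηs zero ↑ʳ_) (joinΣ-splitΣ (ηs ∘ suc) j)) (splitAt⁻¹-↑ʳ eq)

∑-splitΣ : ∀ {m} (ηs : Fin m → ℕ) (f : Σ (Fin m) (Fin ∘ ηs) → ℚ) →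
  ∑ (f ∘ splitΣ ηs) ≡ ∑ (λ k → ∑ (λ t → f (k , t)))
∑-splitΣ {zero}  ηs f = refl
∑-splitΣ {suc m} ηs f = begin
  ∑ (f ∘ splitΣ ηs)
    ≡⟨ ∑-splitAt (ηs zero) (∑ℕ (ηs ∘ suc)) (f ∘ splitΣ ηs) ⟩
  ∑ (λ t → f (splitΣ ηs (t ↑ˡ ∑ℕ (ηs ∘ suc)))) + ∑ (λ j → f (splitΣ ηs (ηs zero ↑ʳ j)))
    ≡⟨ cong₂ _+_ (∑-cong (cong f ∘ splitΣ-↑ˡ)) (∑-cong (cong f ∘ splitΣ-↑ʳ)) ⟩
  ∑ (λ t → f (zero , t)) + ∑ (f₊ ∘ splitΣ (ηs ∘ suc))
    ≡⟨ cong (∑ (λ t → f (zero , t)) +_) (∑-splitΣ (ηs ∘ suc) f₊) ⟩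
  ∑ (λ k → ∑ (λ t → f (k , t)))
    ∎
  where
  open ≡-Reasoning
  f₊ : Σ (Fin m) (Fin ∘ ηs ∘ suc) → ℚ
  f₊ (k , t) = f (suc k , t)
  splitΣ-↑ˡ : ∀ t → splitΣ ηs (t ↑ˡ ∑ℕ (ηs ∘ suc)) ≡ (zero , t)
  splitΣ-↑ˡ t rewrite splitAt-↑ˡ (ηs zero) t (∑ℕ (ηs ∘ suc)) = refl
  splitΣ-↑ʳ : ∀ j → splitΣ ηs (ηs zero ↑ʳ j)
                   ≡ (suc (proj₁ (splitΣ (ηs ∘ suc) j)) , proj₂ (splitΣ (ηs ∘ suc) j))
  splitΣ-↑ʳ j rewrite splitAt-↑ʳ (ηs zero) (∑ℕ (ηs ∘ suc)) j = refl

PreservesCombinations : {Y X : Set} → ((Y → ℚ) → X → ℚ) → Set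
PreservesCombinations {Y} ι = ∀ {d} (c : Fin d → ℚ) (b : Fin d → Y → ℚ) {y} →
  (∀ e → y e ≡ ∑ (λ t → c t * b t e)) → ∀ x → ι y x ≡ ∑ (λ t → c t * ι (b t) x)

record IsDirectSum {X : Set} {m} {Xs : Fin m → Set} (P : (X → ℚ) → Set)
                   (Ps : ∀ k → (Xs k → ℚ) → Set) (ι : ∀ k → (Xs k → ℚ) → X → ℚ) : Set where
  field
    linear    : ∀ k → PreservesCombinations (ι k)
    into      : ∀ k y → Ps k y → P (ι k y)
    spanning  : ∀ x → P x → Σ ((k : Fin m) → Xs k → ℚ) λ ys →
                  (∀ k → Ps k (ys k)) × (∀ v → x v ≡ ∑ (λ k → ι k (ys k) v))
    injective : ∀ (ys : (k : Fin m) → Xs k → ℚ) →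
                  (∀ v → ∑ (λ k → ι k (ys k) v) ≡ 0ℚ) → ∀ k e → ys k e ≡ 0ℚ

module _ {X : Set} {m} {Xs : Fin m → Set} {P : (X → ℚ) → Set} {Ps : ∀ k → (Xs k → ℚ) → Set}
         {ι : ∀ k → (Xs k → ℚ) → X → ℚ} (directSum : IsDirectSum P Ps ι)
         {ηs : Fin m → ℕ} (bases : ∀ k → HasDim (Ps k) (ηs k)) where

  open IsDirectSum directSum

  private
    b : ∀ k → Fin (ηs k) → Xs k → ℚ
    b k = proj₁ (bases k)

    b∈Ps : ∀ k t → Ps k (b k t)
    b∈Ps k = proj₁ (proj₂ (bases k))

    b-independent : ∀ k → LinearlyIndependent (b k)
    b-independent k = proj₁ (proj₂ (proj₂ (bases k)))

    b-spanning : ∀ k y → Ps k y → InSpan (b k) y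
    b-spanning k = proj₂ (proj₂ (proj₂ (bases k)))

    ιb : Σ (Fin m) (Fin ∘ ηs) → X → ℚ
    ιb (k , t) = ι k (b k t)

    concatenated : Fin (∑ℕ ηs) → X → ℚ
    concatenated = ιb ∘ splitΣ ηs

    ι-combination : ∀ (ys : (k : Fin m) → Xs k → ℚ) (c : ∀ k → Fin (ηs k) → ℚ) →
      (∀ k e → ys k e ≡ ∑ (λ t → c k t * b k t e)) →
      ∀ x → ∑ (λ k → ι k (ys k) x) ≡ ∑ (λ i → uncurry c (splitΣ ηs i) * concatenated i x)
    ι-combination ys c ys≡cb x = trans (∑-cong (λ k → linear k (c k) (b k) (ys≡cb k) x))
                                       (sym (∑-splitΣ ηs (λ p → uncurry c p * ιb p x)))

    concatenated-independent : LinearlyIndependent concatenated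
    concatenated-independent c c-vanishes i = begin
      c i                          ≡⟨ cong c (joinΣ-splitΣ ηs i) ⟨
      c (joinΣ ηs (k , t))         ≡⟨ b-independent k (c′ k) (injective ys ys-vanish k) t ⟩
      0ℚ                           ∎
      where
      open ≡-Reasoning
      k = proj₁ (splitΣ ηs i)
      t = proj₂ (splitΣ ηs i)
      c′ : ∀ k → Fin (ηs k) → ℚ
      c′ k t = c (joinΣ ηs (k , t))
      ys : ∀ k → Xs k → ℚ
      ys k e = ∑ (λ t → c′ k t * b k t e)
      ys-vanish : ∀ x → ∑ (λ k → ι k (ys k) x) ≡ 0ℚ
      ys-vanish x = trans (ι-combination ys c′ (λ _ _ → refl) x)
                          (trans (∑-cong (λ i → cong (λ j → c j * concatenated i x) (joinΣ-splitΣ ηs i)))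
                                 (c-vanishes x))

    concatenated-spanning : ∀ v → P v → InSpan concatenated v
    concatenated-spanning v v∈P with spanning v v∈P
    ... | ys , ys∈Ps , v≡∑ys =
      uncurry d ∘ splitΣ ηs , λ x → trans (v≡∑ys x) (ι-combination ys d ys≡db x)
      where
      d : ∀ k → Fin (ηs k) → ℚ
      d k = proj₁ (b-spanning k (ys k) (ys∈Ps k))
      ys≡db : ∀ k e → ys k e ≡ ∑ (λ t → d k t * b k t e)
      ys≡db k = proj₂ (b-spanning k (ys k) (ys∈Ps k))

  HasDim-directSum : HasDim P (∑ℕ ηs)
  HasDim-directSum = concatenated
                   , (λ i → into _ _ (b∈Ps (proj₁ (splitΣ ηs i)) (proj₂ (splitΣ ηs i))))
                   , concatenated-independent
                   , concatenated-spanning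

module _ {n : ℕ} (G : Graph n) where

  open DecMembership (_≟ᶠ_ {n}) using () renaming (_∈?_ to _∈ₗ?_)

  Adj-sym : ∀ {u v} → Adj G u v → Adj G v u
  Adj-sym {u} {v} uv = trans (adj-sym G v u) uv

  Adj-irrefl : ∀ {u} → ¬ Adj G u u
  Adj-irrefl {u} uu with () ← trans (sym (irrefl G u)) uu

  A-adj : ∀ {i j} → Adj G i j → A G i j ≡ 1ℚ
  A-adj ij rewrite ij = refl

  A*-vanishes : ∀ {i j} {z : ℚ} → (Adj G i j → z ≡ 0ℚ) → A G i j * z ≡ 0ℚ
  A*-vanishes {i} {j} {z} z≡0 with adj G i j
  ... | true  = trans (cong (1ℚ *_) (z≡0 refl)) (*-zeroʳ 1ℚ)
  ... | false = *-zeroˡ z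

  ReachIn-source : ∀ {P u v} → ReachIn G P u v → P u
  ReachIn-source (here pu)     = pu
  ReachIn-source (step pu _ _) = pu

  ReachIn-target : ∀ {P u v} → ReachIn G P u v → P v
  ReachIn-target (here pv)    = pv
  ReachIn-target (step _ _ r) = ReachIn-target r

  ReachIn-trans : ∀ {P u v w} → ReachIn G P u v → ReachIn G P v w → ReachIn G P u w
  ReachIn-trans (here _)      r′ = r′
  ReachIn-trans (step pu uv r) r′ = step pu uv (ReachIn-trans r r′)

  ReachIn-sym : ∀ {P u v} → ReachIn G P u v → ReachIn G P v u
  ReachIn-sym (here pu)      = here pu
  ReachIn-sym (step pu uv r) = ReachIn-trans (ReachIn-sym r) (step (ReachIn-source r) (Adj-sym uv) (here pu))

  NullOn : Subset n → (Fin n → ℚ) → Set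
  NullOn R x = ∀ {i} → i ∈ R → ∑ (λ j → A G i j * x j) ≡ 0ℚ

  ZeroOnBoundary : Subset n → (Fin n → ℚ) → Set
  ZeroOnBoundary R x = ∀ {i j} → i ∈ R → j ∉ R → Adj G i j → x j ≡ 0ℚ

  LeafIn : Subset n → Set
  LeafIn R = ∃₂ λ ℓ p → ℓ ∈ R × p ∈ R × Adj G ℓ p × (∀ {w} → w ∈ R → Adj G ℓ w → w ≡ p)

  private
    prefixTo : ∀ {z : Fin n} {xs} → z ∈ₗ xs → List (Fin n)
    prefixTo {xs = x ∷ _} (here _)  = x ∷ []
    prefixTo {xs = x ∷ _} (there p) = x ∷ prefixTo p

    prefixTo-nonempty : ∀ {z xs} (p : z ∈ₗ xs) → 1 ≤ length (prefixTo p)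
    prefixTo-nonempty (here _)  = s≤s z≤n
    prefixTo-nonempty (there _) = s≤s z≤n

    lastOr-prefixTo : ∀ {z xs} (p : z ∈ₗ xs) d → lastOr G d (prefixTo p) ≡ z
    lastOr-prefixTo (here z≡x) _ = sym z≡x
    lastOr-prefixTo {xs = x ∷ _} (there p) _ = lastOr-prefixTo p x

    All-prefixTo : ∀ {P : Fin n → Set} {z xs} (p : z ∈ₗ xs) → All P xs → All P (prefixTo p)
    All-prefixTo (here _)  (px ∷ _)   = px ∷ []
    All-prefixTo (there p) (px ∷ pxs) = px ∷ All-prefixTo p pxs

    Unique-prefixTo : ∀ {z xs} (p : z ∈ₗ xs) → Unique xs → Unique (prefixTo p)
    Unique-prefixTo (here _)  (_ ∷ _)       = [] ∷ []
    Unique-prefixTo (there p) (x∉ ∷ unique) = All-prefixTo p x∉ ∷ Unique-prefixTo p unique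

    AdjChain-prefixTo : ∀ {a z xs} (p : z ∈ₗ xs) → AdjChain G (a ∷ xs) → AdjChain G (a ∷ prefixTo p)
    AdjChain-prefixTo (here _)  (ax , _)     = ax , tt
    AdjChain-prefixTo (there p) (ax , chain) = ax , AdjChain-prefixTo p chain

    closing-cycle : ∀ {w q rest z} → Unique (w ∷ q ∷ rest) → AdjChain G (w ∷ q ∷ rest) →
      (z∈rest : z ∈ₗ rest) → Adj G w z → IsCycle G (w ∷ q ∷ prefixTo z∈rest)
    closing-cycle {w} (w∉ ∷ unique) chain z∈rest wz =
        s≤s (s≤s (prefixTo-nonempty z∈rest))
      , All-prefixTo (there z∈rest) w∉ ∷ Unique-prefixTo (there z∈rest) unique
      , AdjChain-prefixTo (there z∈rest) chain
      , subst (λ u → Adj G u w) (sym (lastOr-prefixTo (there z∈rest) w)) (Adj-sym wz)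

    -- Longest-path argument: the path w ∷ q ∷ rest (newest vertex first) grows inside R
    -- until w has no R-neighbour besides q; a neighbour on the path would close a cycle.
    -- S contains every vertex off the path, so ∣ S ∣ bounds the remaining growth.
    grow : Acyclic G → ∀ {R} (S : Subset n) → Acc _<_ ∣ S ∣ → ∀ {w q rest} →
      (∀ {z} → z ∉ₗ (w ∷ q ∷ rest) → z ∈ S) →
      Unique (w ∷ q ∷ rest) → AdjChain G (w ∷ q ∷ rest) → w ∈ R → q ∈ R → LeafIn R
    grow ac {R} S (acc smaller) {w} {q} {rest} off-path unique chain w∈R q∈R
      with any? (λ z → z ∈? R ×-dec (adj G w z ≟ᵇ true) ×-dec ¬? (z ≟ᶠ q))
    ... | no stuck = w , q , w∈R , q∈R , proj₁ chain ,
                     λ {z} z∈R wz → decidable-stable (z ≟ᶠ q) (λ z≢q → stuck (z , z∈R , wz , z≢q))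
    ... | yes (z , z∈R , wz , z≢q) with z ∈ₗ? (w ∷ q ∷ rest)
    ...   | yes (here refl)            = contradiction wz Adj-irrefl
    ...   | yes (there (here z≡q))     = contradiction z≡q z≢q
    ...   | yes (there (there z∈rest)) = contradiction (closing-cycle unique chain z∈rest wz) (ac _)
    ...   | no z∉path = grow ac (S ─ ⁅ z ⁆) (smaller (x∈p⇒∣p-x∣<∣p∣ (off-path z∉path))) off-path′
                          (¬Any⇒All¬ _ z∉path ∷ unique) (Adj-sym wz , chain) z∈R w∈R
      where
      off-path′ : ∀ {y} → y ∉ₗ (z ∷ w ∷ q ∷ rest) → y ∈ S ─ ⁅ z ⁆
      off-path′ y∉ = x∈p∧x≢y⇒x∈p-y (off-path (y∉ ∘ there)) (y∉ ∘ here)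

  acyclic-leaf : Acyclic G → ∀ {R u v} → u ∈ R → v ∈ R → Adj G u v → LeafIn R
  acyclic-leaf ac u∈R v∈R uv =
    grow ac ⊤ (<-wellFounded _) (λ _ → ∈⊤) (((λ { refl → Adj-irrefl uv }) ∷ []) ∷ [] ∷ []) (uv , tt)
         u∈R v∈R

  null-at-leaf-neighbour : ∀ {R x ℓ p} → NullOn R x → ZeroOnBoundary R x →
    ℓ ∈ R → Adj G ℓ p → (∀ {w} → w ∈ R → Adj G ℓ w → w ≡ p) → x p ≡ 0ℚ
  null-at-leaf-neighbour {R} {x} {ℓ} {p} null boundary ℓ∈R ℓp only-p = begin
    x p                        ≡⟨ *-identityˡ (x p) ⟨
    1ℚ * x p                   ≡⟨ cong (_* x p) (A-adj ℓp) ⟨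
    A G ℓ p * x p              ≡⟨ ∑-single p others ⟨
    ∑ (λ j → A G ℓ j * x j)    ≡⟨ null ℓ∈R ⟩
    0ℚ                         ∎
    where
    open ≡-Reasoning
    others : ∀ j → j ≢ p → A G ℓ j * x j ≡ 0ℚ
    others j j≢p = A*-vanishes (by-membership (j ∈? R))
      where
      by-membership : Dec (j ∈ R) → Adj G ℓ j → x j ≡ 0ℚ
      by-membership (yes j∈R) ℓj = contradiction (only-p j∈R ℓj) j≢p
      by-membership (no j∉R)  ℓj = boundary ℓ∈R j∉R ℓj

  NullOn-remove : ∀ {R x} p → NullOn R x → NullOn (R ─ ⁅ p ⁆) x
  NullOn-remove {R} p null i∈R-p = null (p─q⊆p R ⁅ p ⁆ i∈R-p)

  ZeroOnBoundary-remove : ∀ {R x p} → ZeroOnBoundary R x → x p ≡ 0ℚ → ZeroOnBoundary (R ─ ⁅ p ⁆) x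
  ZeroOnBoundary-remove {R} {x} {p} boundary xp≡0 {i} {j} i∈R-p j∉R-p ij with j ≟ᶠ p
  ... | yes refl = xp≡0
  ... | no j≢p   = boundary (p─q⊆p R ⁅ p ⁆ i∈R-p) (λ j∈R → j∉R-p (x∈p∧x≢y⇒x∈p-y j∈R j≢p)) ij

  acyclic-null-edge : Acyclic G → ∀ {R x y u v} →
    NullOn R x → ZeroOnBoundary R x → NullOn R y → ZeroOnBoundary R y →
    u ∈ R → v ∈ R → Adj G u v → x u ≡ 0ℚ ⊎ y v ≡ 0ℚ
  acyclic-null-edge ac = go (<-wellFounded _)
    where
    go : ∀ {R x y u v} → Acc _<_ ∣ R ∣ →
      NullOn R x → ZeroOnBoundary R x → NullOn R y → ZeroOnBoundary R y →
      u ∈ R → v ∈ R → Adj G u v → x u ≡ 0ℚ ⊎ y v ≡ 0ℚ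
    go {R} {x} {y} {u} {v} (acc smaller) null-x zero-x null-y zero-y u∈R v∈R uv =
      at-leaf (acyclic-leaf ac u∈R v∈R uv)
      where
      remove : ∀ {p} → p ∈ R → x p ≡ 0ℚ → y p ≡ 0ℚ → x u ≡ 0ℚ ⊎ y v ≡ 0ℚ
      remove {p} p∈R xp≡0 yp≡0 with u ≟ᶠ p | v ≟ᶠ p
      ... | yes refl | _        = inj₁ xp≡0
      ... | no _     | yes refl = inj₂ yp≡0
      ... | no u≢p   | no v≢p   =
        go (smaller (x∈p⇒∣p-x∣<∣p∣ p∈R))
           (NullOn-remove p null-x) (ZeroOnBoundary-remove zero-x xp≡0)
           (NullOn-remove p null-y) (ZeroOnBoundary-remove zero-y yp≡0)
           (x∈p∧x≢y⇒x∈p-y u∈R u≢p) (x∈p∧x≢y⇒x∈p-y v∈R v≢p) uv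

      at-leaf : LeafIn R → x u ≡ 0ℚ ⊎ y v ≡ 0ℚ
      at-leaf (ℓ , p , ℓ∈R , p∈R , ℓp , only-p) =
        remove p∈R (null-at-leaf-neighbour null-x zero-x ℓ∈R ℓp only-p)
                   (null-at-leaf-neighbour null-y zero-y ℓ∈R ℓp only-p)

module _ {n : ℕ} {P : Fin n → Set} (P? : ∀ w → Dec (P w)) where

  subsetOf : Subset n
  subsetOf = tabulate (does ∘ P?)

  ∈-subsetOf⁺ : ∀ {w} → P w → w ∈ subsetOf
  ∈-subsetOf⁺ {w} pw = lookup⇒[]= w subsetOf (trans (lookup∘tabulate (does ∘ P?) w) (dec-true (P? w) pw))

  ∈-subsetOf⁻ : ∀ {w} → w ∈ subsetOf → P w
  ∈-subsetOf⁻ {w} w∈ = witness (P? w) (trans (sym (lookup∘tabulate (does ∘ P?) w)) ([]=⇒lookup w∈))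
    where
    witness : (p? : Dec (P w)) → does p? ≡ true → P w
    witness (yes pw) _ = pw

¬¬-decidable : ∀ {n} (P : Fin n → Set) → ¬ ¬ (∀ w → Dec (P w))
¬¬-decidable {zero}  P ¬P? = ¬P? λ ()
¬¬-decidable {suc n} P ¬P? = ¬¬-excluded-middle λ P₀? →
  ¬¬-decidable (P ∘ suc) λ P₊? → ¬P? λ { zero → P₀? ; (suc w) → P₊? w }

module _ {n : ℕ} (T : Graph n) where

  restrict : ∀ {S} → (Fin n → ℚ) → Elem T S → ℚ
  restrict x = x ∘ proj₁

  lift-∈ : ∀ S y {v} (v∈S : v ∈ S) → lift T S y v ≡ y (v , v∈S)
  lift-∈ S y {v} v∈S with v ∈? S
  ... | yes v∈S′ = cong (λ v∈ → y (v , v∈)) ([]=-irrelevant v∈S′ v∈S)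
  ... | no v∉S   = contradiction v∈S v∉S

  lift-∉ : ∀ S y {v} → v ∉ S → lift T S y v ≡ 0ℚ
  lift-∉ S y {v} v∉S with v ∈? S
  ... | yes v∈S = contradiction v∈S v∉S
  ... | no _    = refl

  rowIn≡A*lift : ∀ S y i j → rowIn T S y i j ≡ A T i j * lift T S y j
  rowIn≡A*lift S y i j with j ∈? S
  ... | yes _ = refl
  ... | no _  = sym (*-zeroʳ (A T i j))

  IsNullIn⇒NullOn-lift : ∀ {S y} → IsNullIn T S y → NullOn T S (lift T S y)
  IsNullIn⇒NullOn-lift {S} {y} null {i} i∈S = trans (∑-cong (sym ∘ rowIn≡A*lift S y i)) (null (i , i∈S))

  NullOn-lift⇒IsNullIn : ∀ {S y} → NullOn T S (lift T S y) → IsNullIn T S y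
  NullOn-lift⇒IsNullIn {S} {y} null (i , i∈S) = trans (∑-cong (rowIn≡A*lift S y i)) (null i∈S)

  ZeroOnBoundary-lift : ∀ {S} y → ZeroOnBoundary T S (lift T S y)
  ZeroOnBoundary-lift {S} y _ j∉S _ = lift-∉ S y j∉S

  lift-preservesCombinations : ∀ S → PreservesCombinations (lift T S)
  lift-preservesCombinations S c b y≡cb v with v ∈? S
  ... | yes v∈S = y≡cb (v , v∈S)
  ... | no _    = sym (∑-zero (λ t → *-zeroʳ (c t)))

  NullOn-lift-restrict : ∀ {S x} → NullOn T S x → ZeroOnBoundary T S x → NullOn T S (lift T S (restrict x))
  NullOn-lift-restrict {S} {x} null boundary {i} i∈S = trans (∑-cong same-term) (null i∈S)
    where
    same-term : ∀ j → A T i j * lift T S (restrict x) j ≡ A T i j * x j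
    same-term j with j ∈? S
    ... | yes _   = refl
    ... | no j∉S  = trans (*-zeroʳ (A T i j)) (sym (A*-vanishes T (boundary i∈S j∉S)))

  module _ {C : Subset n} (C-component : IsSuppComponent T C) where

    component-closed : ∀ {u v} → u ∈ C → NSupp T v → Adj T u v → v ∈ C
    component-closed = proj₂ (proj₂ (proj₂ C-component)) _ _

    component-closed-walk : ∀ {u w} → u ∈ C → ReachIn T (NSupp T) u w → w ∈ C
    component-closed-walk u∈C (here _)      = u∈C
    component-closed-walk u∈C (step _ uv r) = component-closed-walk (component-closed u∈C (ReachIn-source T r) uv) r

    null-ZeroOnBoundary : ∀ {x} → IsNull T x → ZeroOnBoundary T C x
    null-ZeroOnBoundary {x} null i∈C j∉C ij =
      decidable-stable (_ ≟ℚ 0ℚ) λ xj≢0 →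
        j∉C (component-closed i∈C (_ , (x , null , xj≢0) , inj₁ refl) ij)

    -- j ∉ Supp T (else i ∈ N[Supp T] would lie in C), so j has a neighbour u ∈ Supp T ∩ C.
    lift-null-at-exit : Acyclic T → ∀ {y i j} → IsNullIn T C y →
                        j ∈ C → i ∉ C → Adj T j i → lift T C y j ≡ 0ℚ
    lift-null-at-exit ac {y} {i} {j} null-y j∈C i∉C ji with proj₁ (proj₂ C-component) j j∈C
    ... | u , j-supp , inj₁ refl = contradiction (component-closed j∈C (j , j-supp , inj₂ ji) ji) i∉C
    ... | u , (x , null-x , xu≢0) , inj₂ uj =
      fromInj₂ (λ xu≡0 → contradiction xu≡0 xu≢0)
               (acyclic-null-edge T ac (λ {i} _ → null-x i) (null-ZeroOnBoundary null-x)
                                       (IsNullIn⇒NullOn-lift null-y) (ZeroOnBoundary-lift y) u∈C j∈C uj)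
      where u∈C = component-closed j∈C (u , (x , null-x , xu≢0) , inj₁ refl) (Adj-sym T uj)

    lift-isNull : Acyclic T → ∀ {y} → IsNullIn T C y → IsNull T (lift T C y)
    lift-isNull ac {y} null-y i with i ∈? C
    ... | yes i∈C = IsNullIn⇒NullOn-lift null-y i∈C
    ... | no i∉C  = ∑-zero λ j → A*-vanishes T (exit (j ∈? C))
      where
      exit : ∀ {j} → Dec (j ∈ C) → Adj T i j → lift T C y j ≡ 0ℚ
      exit (yes j∈C) ij = lift-null-at-exit ac null-y j∈C i∉C (Adj-sym T ij)
      exit (no j∉C)  _  = lift-∉ C y j∉C

    restrict-isNullIn : ∀ {x} → IsNull T x → IsNullIn T C (restrict x)
    restrict-isNullIn null =
      NullOn-lift⇒IsNullIn (NullOn-lift-restrict (λ {i} _ → null i) (null-ZeroOnBoundary null))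

  reachable-component : ∀ {v} → NSupp T v → (reach? : ∀ w → Dec (ReachIn T (NSupp T) v w)) →
    IsSuppComponent T (subsetOf reach?)
  reachable-component v∈N reach? =
      (_ , ∈-subsetOf⁺ reach? (here v∈N))
    , (λ w w∈ → ReachIn-target T (∈-subsetOf⁻ reach? w∈))
    , (λ u w u∈ w∈ → ReachIn-trans T (ReachIn-sym T (∈-subsetOf⁻ reach? u∈)) (∈-subsetOf⁻ reach? w∈))
    , (λ u w u∈ w∈N uw → ∈-subsetOf⁺ reach? (ReachIn-trans T (∈-subsetOf⁻ reach? u∈)
                                                 (step (ReachIn-target T (∈-subsetOf⁻ reach? u∈)) uw (here w∈N))))

  module _ {m} {Cs : Fin m → Subset n} (enum : EnumeratesFS T Cs) where

    private
      component = proj₁ enum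
      injective = proj₁ (proj₂ enum)
      surjective = proj₂ (proj₂ enum)

    components-disjoint : ∀ {v k l} → v ∈ Cs k → v ∈ Cs l → k ≡ l
    components-disjoint {v} {k} {l} v∈Cₖ v∈Cₗ =
      injective k l (⊆-antisym (⊆-sharing (component k) (component l) v∈Cₖ v∈Cₗ)
                               (⊆-sharing (component l) (component k) v∈Cₗ v∈Cₖ))
      where
      ⊆-sharing : ∀ {C D} → IsSuppComponent T C → IsSuppComponent T D →
                  v ∈ C → v ∈ D → ∀ {w} → w ∈ C → w ∈ D
      ⊆-sharing C-comp D-comp v∈C v∈D w∈C =
        component-closed-walk D-comp v∈D (proj₁ (proj₂ (proj₂ C-comp)) _ _ v∈C w∈C)

    -- N[Supp T] is not decidable (Supp quantifies over ℚⁿ), so the component of v only exists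
    -- under ¬¬; it is used below only to prove a decidable equation.
    NSupp-covered : ∀ {v} → NSupp T v → ¬ ¬ ∃ λ k → v ∈ Cs k
    NSupp-covered {v} v∈N = ¬¬-map covered (¬¬-decidable (ReachIn T (NSupp T) v))
      where
      covered : (∀ w → Dec (ReachIn T (NSupp T) v w)) → ∃ λ k → v ∈ Cs k
      covered reach? with surjective (subsetOf reach?) (reachable-component v∈N reach?)
      ... | k , Cₖ≡ = k , subst (v ∈_) (sym Cₖ≡) (∈-subsetOf⁺ reach? (here v∈N))

    ∑-lift-component : ∀ (ys : (k : Fin m) → Elem T (Cs k) → ℚ) {v k} (v∈Cₖ : v ∈ Cs k) →
      ∑ (λ l → lift T (Cs l) (ys l) v) ≡ ys k (v , v∈Cₖ)
    ∑-lift-component ys {v} {k} v∈Cₖ =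
      trans (∑-single k others) (lift-∈ (Cs k) (ys k) v∈Cₖ)
      where
      others : ∀ l → l ≢ k → lift T (Cs l) (ys l) v ≡ 0ℚ
      others l l≢k = lift-∉ (Cs l) (ys l) (λ v∈Cₗ → l≢k (components-disjoint v∈Cₗ v∈Cₖ))

    ∑-lift-restrict : ∀ {x} → IsNull T x → ∀ v → x v ≡ ∑ (λ k → lift T (Cs k) (restrict x) v)
    ∑-lift-restrict {x} null v with x v ≟ℚ 0ℚ
    ... | yes xv≡0 = trans xv≡0 (sym (∑-zero vanishes))
      where
      vanishes : ∀ k → lift T (Cs k) (restrict x) v ≡ 0ℚ
      vanishes k with v ∈? Cs k
      ... | yes _ = xv≡0
      ... | no _  = refl
    ... | no xv≢0 = decidable-stable (x v ≟ℚ _)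
      (¬¬-map (λ (k , v∈Cₖ) → sym (∑-lift-component (λ _ → restrict x) v∈Cₖ))
              (NSupp-covered (v , (x , null , xv≢0) , inj₁ refl)))

    nullSpace-isDirectSum : Acyclic T →
      IsDirectSum (IsNull T) (λ k → IsNullIn T (Cs k)) (λ k → lift T (Cs k))
    nullSpace-isDirectSum ac = record
      { linear    = λ k → lift-preservesCombinations (Cs k)
      ; into      = λ k y → lift-isNull (component k) ac
      ; spanning  = λ x null →
                      (λ _ → restrict x) , (λ k → restrict-isNullIn (component k) null) , ∑-lift-restrict null
      ; injective = λ ys ∑≡0 k (v , v∈Cₖ) → trans (sym (∑-lift-component ys v∈Cₖ)) (∑≡0 v)
      }

mainTheorem3 : ∀ {n} (T : Graph n) → IsTree T →
    ∀ {m} (Cs : Fin m → Subset n) → EnumeratesFS T Cs →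
    DirectSumDecomp T Cs
    × (∀ (η : ℕ) (ηs : Fin m → ℕ) → HasDim (IsNull T) η →
         (∀ k → HasDim (IsNullIn T (Cs k)) (ηs k)) → η ≡ ∑ℕ ηs)
mainTheorem3 T (_ , _ , acyclic) Cs enum = (into , spanning , λ ys _ → injective ys) , dimension
  where
  directSum = nullSpace-isDirectSum T enum acyclic
  open IsDirectSum directSum
  dimension : ∀ η ηs → HasDim (IsNull T) η → (∀ k → HasDim (IsNullIn T (Cs k)) (ηs k)) → η ≡ ∑ℕ ηs
  dimension η ηs dim dims = HasDim-unique dim (HasDim-directSum directSum dims)
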